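{- A set $M\subseteq\omega$ is weakly semirecursive if and only if $M$ is an initial segment of some recursively enumerable quasi-ordering on $\omega$.
   Context: $M\subseteq\omega$ is weakly semirecursive if there is a partial recursive function $\psi$ of two variables such that for all $x,y\in\omega$: if exactly one of $x,y$ belongs to $M$, then $\psi(x,y)$ is defined and $\psi(x,y)\in\{x,y\}\cap M$. A quasi-ordering $\preceq$ on $\omega$ is recursively enumerable if the set of pairs $(x,y)$ with $x\preceq y$ is r.e. For a quasi-ordering $\preceq$ on $\omega$, $M\subseteq\omega$ is an initial segment of $\preceq$ if every element of $M$ is strictly smaller (i.e. $x\preceq y$ and not $y\preceq x$) than every element of the complement $\omega\setminus M$. -}

module Defs where

open import Data.Nat using (ℕ; zero; suc; _<_)
open import Data.Fin using (Fin)
open import Data.Vec using (Vec; []; _∷_; lookup)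
open import Data.Product using (Σ; ∃; _×_; _,_)
open import Data.Sum using (_⊎_)
open import Relation.Nullary using (¬_)
open import Relation.Binary.PropositionalEquality using (_≡_)
open import Relation.Binary.Structures using (IsPreorder)

data PR : ℕ → Set where
  zer  : ∀ {n} → PR n
  succ : PR 1
  proj : ∀ {n} → Fin n → PR n
  comp : ∀ {m n} → PR m → Vec (PR n) m → PR n
  prec : ∀ {n} → PR n → PR (suc (suc n)) → PR (suc n)
  mu   : ∀ {n} → PR (suc n) → PR n

mutual
  data Eval : ∀ {n} → PR n → Vec ℕ n → ℕ → Set where
    ev-zer  : ∀ {n} {xs : Vec ℕ n} → Eval zer xs 0
    ev-succ : ∀ {x} → Eval succ (x ∷ []) (suc x)
    ev-proj : ∀ {n} {i : Fin n} {xs} → Eval (proj i) xs (lookup xs i)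
    ev-comp : ∀ {m n} {f : PR m} {gs : Vec (PR n) m} {xs ys v} →
              EvalVec gs xs ys → Eval f ys v → Eval (comp f gs) xs v
    ev-prec-zero : ∀ {n} {g : PR n} {h xs v} →
              Eval g xs v → Eval (prec g h) (0 ∷ xs) v
    ev-prec-suc  : ∀ {n} {g : PR n} {h k xs r v} →
              Eval (prec g h) (k ∷ xs) r → Eval h (k ∷ r ∷ xs) v →
              Eval (prec g h) (suc k ∷ xs) v
    ev-mu   : ∀ {n} {f : PR (suc n)} {xs y} →
              Eval f (y ∷ xs) 0 →
              (∀ z → z < y → Σ ℕ λ k → Eval f (z ∷ xs) (suc k)) →
              Eval (mu f) xs y

  data EvalVec : ∀ {m n} → Vec (PR n) m → Vec ℕ n → Vec ℕ m → Set where
    evv-[] : ∀ {n} {xs : Vec ℕ n} → EvalVec [] xs []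
    evv-∷  : ∀ {m n} {g : PR n} {gs : Vec (PR n) m} {xs y ys} →
             Eval g xs y → EvalVec gs xs ys → EvalVec (g ∷ gs) xs (y ∷ ys)

Subset : Set₁
Subset = ℕ → Set

Rel₂ : Set₁
Rel₂ = ℕ → ℕ → Set

ExactlyOne : Subset → ℕ → ℕ → Set
ExactlyOne M x y = (M x × ¬ M y) ⊎ (¬ M x × M y)

WeaklySemirecursive : Subset → Set
WeaklySemirecursive M =
  Σ (PR 2) λ ψ → ∀ x y → ExactlyOne M x y →
    Σ ℕ λ v → Eval ψ (x ∷ y ∷ []) v × (v ≡ x ⊎ v ≡ y) × M v

RecEnum : Rel₂ → Set
RecEnum R = Σ (PR 2) λ e → ∀ x y →
  (R x y → ∃ λ v → Eval e (x ∷ y ∷ []) v) × ((∃ λ v → Eval e (x ∷ y ∷ []) v) → R x y)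

QuasiOrdering : Rel₂ → Set
QuasiOrdering _≼_ = IsPreorder _≡_ _≼_

Strictly : Rel₂ → ℕ → ℕ → Set
Strictly _≼_ x y = x ≼ y × ¬ (y ≼ x)

InitialSegment : Rel₂ → Subset → Set
InitialSegment _≼_ M = ∀ x y → M x → ¬ M y → Strictly _≼_ x y

-- (⇐) If M is an initial segment of an r.e. quasi-ordering ≼, a selector on
-- x, y enumerates ≼ until x ≼ y or y ≼ x shows up, and answers x in the first
-- case and y otherwise: when exactly one of x, y lies in M, only the comparison
-- from the element of M to the other one holds.
-- (⇒) Given a selector ψ, take for ≼ the reflexive–transitive closure of
-- "ψ(x, y) = x".  For x ∈ M and y ∉ M this gives x ≼ y, while a step a ≼ b with
-- a ∉ M forces b ∉ M (otherwise ψ(a, b) would have to be b), so no chain leads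
-- from y back to x.
-- Both enumerability claims go through Σ₁ presentations R x y ⟺ ∃ t. χ(t, x, y) > 0
-- with χ total recursive: a step-counting interpreter for partial recursive codes
-- supplies χ for the graph of ψ and for any r.e. relation, and a chain is
-- certified by a Cantor-coded list of its steps together with their certificates.

module Submission where

open import Defs
open import Data.Nat using (ℕ; zero; suc; pred; _+_; _∸_; _⊔_; _≤_; _<_; s≤s)
open import Data.Nat.Properties
open import Data.Fin using (Fin; zero; suc)
open import Data.Vec using (Vec; []; _∷_; head; tail; lookup; tabulate; map)
open import Data.Vec.Properties using (tabulate∘lookup; map-∘; map-id)
open import Data.Product using (Σ; ∃; ∃₂; _×_; _,_; proj₁; proj₂)
open import Data.Sum using (_⊎_; inj₁; inj₂)
open import Function.Base using (_∘_)
open import Function.Bundles using (_⇔_; mk⇔)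
open import Relation.Nullary using (¬_; contradiction)
open import Relation.Binary.Definitions using (tri<; tri≈; tri>)
open import Relation.Binary.PropositionalEquality
open import Relation.Binary.Construct.Closure.ReflexiveTransitive using (Star; ε; _◅_)
open import Relation.Binary.Construct.Closure.ReflexiveTransitive.Properties
  using () renaming (isPreorder to Star-isPreorder)

private
  variable
    m n : ℕ
    f g h : Vec ℕ n → ℕ

mutual
  Eval-deterministic : ∀ {f : PR n} {xs v w} → Eval f xs v → Eval f xs w → v ≡ w
  Eval-deterministic ev-zer ev-zer = refl
  Eval-deterministic ev-succ ev-succ = refl
  Eval-deterministic ev-proj ev-proj = refl
  Eval-deterministic (ev-comp gs f) (ev-comp gs′ f′)
    rewrite EvalVec-deterministic gs gs′ = Eval-deterministic f f′
  Eval-deterministic (ev-prec-zero g) (ev-prec-zero g′) = Eval-deterministic g g′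
  Eval-deterministic (ev-prec-suc r h) (ev-prec-suc r′ h′)
    rewrite Eval-deterministic r r′ = Eval-deterministic h h′
  Eval-deterministic (ev-mu {y = y} f below) (ev-mu {y = y′} f′ below′) with <-cmp y y′
  ... | tri< y<y′ _ _ = contradiction (Eval-deterministic f (proj₂ (below′ y y<y′))) 0≢1+n
  ... | tri≈ _ y≡y′ _ = y≡y′
  ... | tri> _ _ y′<y = contradiction (Eval-deterministic f′ (proj₂ (below y′ y′<y))) 0≢1+n

  EvalVec-deterministic : ∀ {gs : Vec (PR n) m} {xs ys ys′} →
                          EvalVec gs xs ys → EvalVec gs xs ys′ → ys ≡ ys′
  EvalVec-deterministic evv-[] evv-[] = refl
  EvalVec-deterministic (evv-∷ g gs) (evv-∷ g′ gs′) =
    cong₂ _∷_ (Eval-deterministic g g′) (EvalVec-deterministic gs gs′)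

record Computable (n : ℕ) (f : Vec ℕ n → ℕ) : Set where
  constructor computable
  field
    code : PR n
    eval : ∀ xs → Eval code xs (f xs)
open Computable

record ComputableVec (n m : ℕ) (F : Vec ℕ n → Vec ℕ m) : Set where
  constructor computableVec
  field
    codes : Vec (PR n) m
    evals : ∀ xs → EvalVec codes xs (F xs)
open ComputableVec

Computable₁ : (ℕ → ℕ) → Set
Computable₁ f = Computable 1 (λ v → f (head v))

Computable₂ : (ℕ → ℕ → ℕ) → Set
Computable₂ f = Computable 2 (λ v → f (head v) (head (tail v)))

Computable₃ : (ℕ → ℕ → ℕ → ℕ) → Set
Computable₃ f = Computable 3 (λ v → f (head v) (head (tail v)) (head (tail (tail v))))

cast : Computable n f → (∀ xs → f xs ≡ g xs) → Computable n g
cast (computable c ev) f≗g = computable c (λ xs → subst (Eval c xs) (f≗g xs) (ev xs))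

castVec : ∀ {F G : Vec ℕ n → Vec ℕ m} →
          ComputableVec n m F → (∀ xs → F xs ≡ G xs) → ComputableVec n m G
castVec (computableVec cs evs) F≗G = computableVec cs (λ xs → subst (EvalVec cs xs) (F≗G xs) (evs xs))

zeroᶜ : Computable n (λ _ → 0)
zeroᶜ = computable zer (λ _ → ev-zer)

sucᶜ : Computable₁ suc
sucᶜ = computable succ (λ { (_ ∷ []) → ev-succ })

projᶜ : (i : Fin n) → Computable n (λ xs → lookup xs i)
projᶜ i = computable (proj i) (λ _ → ev-proj)

[]ᶜ : ComputableVec n 0 (λ _ → [])
[]ᶜ = computableVec [] (λ _ → evv-[])

infixr 5 _∷ᶜ_
_∷ᶜ_ : ∀ {F : Vec ℕ n → Vec ℕ m} → Computable n f → ComputableVec n m F →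
       ComputableVec n (suc m) (λ xs → f xs ∷ F xs)
computable c ev ∷ᶜ computableVec cs evs = computableVec (c ∷ cs) (λ xs → evv-∷ (ev xs) (evs xs))

compose : ∀ {f : Vec ℕ m → ℕ} {F : Vec ℕ n → Vec ℕ m} →
          Computable m f → ComputableVec n m F → Computable n (λ xs → f (F xs))
compose {F = F} (computable c ev) (computableVec cs evs) =
  computable (comp c cs) (λ xs → ev-comp (evs xs) (ev (F xs)))

apply₁ : ∀ {f} → Computable 1 f → Computable n g → Computable n (λ xs → f (g xs ∷ []))
apply₁ F G = compose F (G ∷ᶜ []ᶜ)

apply₂ : ∀ {f} → Computable 2 f → Computable n g → Computable n h →
         Computable n (λ xs → f (g xs ∷ h xs ∷ []))
apply₂ F G H = compose F (G ∷ᶜ H ∷ᶜ []ᶜ)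

apply₃ : ∀ {f i} → Computable 3 f → Computable n g → Computable n h → Computable n i →
         Computable n (λ xs → f (g xs ∷ h xs ∷ i xs ∷ []))
apply₃ F G H I = compose F (G ∷ᶜ H ∷ᶜ I ∷ᶜ []ᶜ)

oneᶜ : Computable n (λ _ → 1)
oneᶜ = apply₁ sucᶜ zeroᶜ

projections : (φ : Fin m → Fin n) → ComputableVec n m (λ xs → tabulate (λ i → lookup xs (φ i)))
projections {zero} φ = []ᶜ
projections {suc m} φ = projᶜ (φ zero) ∷ᶜ projections (φ ∘ suc)

drop₁ : ComputableVec (1 + n) n tail
drop₁ = castVec (projections suc) (λ { (_ ∷ xs) → tabulate∘lookup xs })

drop₂ : ComputableVec (2 + n) n (tail ∘ tail)
drop₂ = castVec (projections (λ i → suc (suc i))) (λ { (_ ∷ _ ∷ xs) → tabulate∘lookup xs })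

drop₃ : ComputableVec (3 + n) n (tail ∘ tail ∘ tail)
drop₃ = castVec (projections (λ i → suc (suc (suc i)))) (λ { (_ ∷ _ ∷ _ ∷ xs) → tabulate∘lookup xs })

primRecFn : (Vec ℕ n → ℕ) → (Vec ℕ (2 + n) → ℕ) → Vec ℕ (suc n) → ℕ
primRecFn g h (zero ∷ xs) = g xs
primRecFn g h (suc m ∷ xs) = h (m ∷ primRecFn g h (m ∷ xs) ∷ xs)

primRec : Computable n g → Computable (2 + n) h → Computable (suc n) (primRecFn g h)
primRec {g = g} {h = h} (computable cg evg) (computable ch evh) = computable (prec cg ch) eval-prec
  where
  eval-prec : ∀ xs → Eval (prec cg ch) xs (primRecFn g h xs)
  eval-prec (zero ∷ xs) = ev-prec-zero (evg xs)
  eval-prec (suc m ∷ xs) = ev-prec-suc (eval-prec (m ∷ xs)) (evh _)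

caseFn : (Vec ℕ n → ℕ) → (Vec ℕ (suc n) → ℕ) → Vec ℕ (suc n) → ℕ
caseFn g h (zero ∷ xs) = g xs
caseFn g h (suc m ∷ xs) = h (m ∷ xs)

caseᶜ : Computable n g → Computable (suc n) h → Computable (suc n) (caseFn g h)
caseᶜ G H = cast (primRec G (compose H (projᶜ zero ∷ᶜ drop₂)))
                 (λ { (zero ∷ xs) → refl ; (suc m ∷ xs) → refl })

computedFn : Computable n f → Vec ℕ n → ℕ
computedFn {f = f} _ = f

ifPos : ℕ → ℕ → ℕ
ifPos zero b = zero
ifPos (suc a) b = b

isZero : ℕ → ℕ
isZero zero = 1
isZero (suc _) = 0

select : ℕ → ℕ → ℕ → ℕ
select zero a b = b
select (suc _) a b = a

ifPos-zero : ∀ a → ifPos a 0 ≡ 0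
ifPos-zero zero = refl
ifPos-zero (suc _) = refl

eq : ℕ → ℕ → ℕ
eq zero zero = 1
eq zero (suc b) = 0
eq (suc a) zero = 0
eq (suc a) (suc b) = eq a b

eq-refl : ∀ a → eq a a ≡ 1
eq-refl zero = refl
eq-refl (suc a) = eq-refl a

eq-pos⇒≡ : ∀ a b {w} → eq a b ≡ suc w → a ≡ b
eq-pos⇒≡ zero zero _ = refl
eq-pos⇒≡ (suc a) (suc b) e = cong suc (eq-pos⇒≡ a b e)

≢⇒eq-zero : ∀ a b → a ≢ b → eq a b ≡ 0
≢⇒eq-zero zero zero a≢b = contradiction refl a≢b
≢⇒eq-zero zero (suc b) _ = refl
≢⇒eq-zero (suc a) zero _ = refl
≢⇒eq-zero (suc a) (suc b) a≢b = ≢⇒eq-zero a b (a≢b ∘ cong suc)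

predᶜ : Computable₁ pred
predᶜ = cast (caseᶜ zeroᶜ (projᶜ zero)) (λ { (zero ∷ []) → refl ; (suc _ ∷ []) → refl })

isZeroᶜ : Computable₁ isZero
isZeroᶜ = cast (caseᶜ oneᶜ zeroᶜ) (λ { (zero ∷ []) → refl ; (suc _ ∷ []) → refl })

ifPosᶜ : Computable₂ ifPos
ifPosᶜ = cast (caseᶜ zeroᶜ (projᶜ (suc zero)))
              (λ { (zero ∷ _ ∷ []) → refl ; (suc _ ∷ _ ∷ []) → refl })

selectᶜ : Computable₃ select
selectᶜ = cast (caseᶜ (projᶜ (suc zero)) (projᶜ (suc zero)))
               (λ { (zero ∷ _ ∷ _ ∷ []) → refl ; (suc _ ∷ _ ∷ _ ∷ []) → refl })

addᶜ : Computable₂ _+_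
addᶜ = cast (primRec (projᶜ zero) (apply₁ sucᶜ (projᶜ (suc zero)))) (λ { (a ∷ b ∷ []) → add a b })
  where
  add : ∀ a b → primRecFn (λ v → lookup v zero) (λ v → suc (lookup v (suc zero))) (a ∷ b ∷ []) ≡ a + b
  add zero b = refl
  add (suc a) b = cong suc (add a b)

monusᶜ : Computable₂ _∸_
monusᶜ = cast (apply₂ flipped (projᶜ (suc zero)) (projᶜ zero)) (λ { (a ∷ b ∷ []) → monus b a })
  where
  flipped : Computable 2 (primRecFn (λ v → lookup v zero) (λ v → pred (lookup v (suc zero))))
  flipped = primRec (projᶜ zero) (apply₁ predᶜ (projᶜ (suc zero)))
  monus : ∀ b a → primRecFn (λ v → lookup v zero) (λ v → pred (lookup v (suc zero))) (b ∷ a ∷ [])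
                ≡ a ∸ b
  monus zero a = refl
  monus (suc b) a = trans (cong pred (monus b a)) (pred[m∸n]≡m∸[1+n] a b)

eqᶜ : Computable₂ eq
eqᶜ = cast (apply₁ isZeroᶜ (apply₂ addᶜ (apply₂ monusᶜ (projᶜ zero) (projᶜ (suc zero)))
                                         (apply₂ monusᶜ (projᶜ (suc zero)) (projᶜ zero))))
           (λ { (a ∷ b ∷ []) → distance a b })
  where
  distance : ∀ a b → isZero ((a ∸ b) + (b ∸ a)) ≡ eq a b
  distance zero zero = refl
  distance zero (suc b) = refl
  distance (suc a) zero = refl
  distance (suc a) (suc b) = distance a b

-- States of a bounded μ-search: 0 = some probe is still undefined, 1 = no zero
-- found yet, 2 + y = the least zero is y.  Probes, and pred of the final state,
-- use the encoding of run below.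
searchStep : ℕ → ℕ → ℕ → ℕ
searchStep zero j c = zero
searchStep (suc zero) j zero = zero
searchStep (suc zero) j (suc zero) = suc (suc j)
searchStep (suc zero) j (suc (suc c)) = suc zero
searchStep (suc (suc s)) j c = suc (suc s)

search : (ℕ → ℕ) → ℕ → ℕ
search r zero = 1
search r (suc j) = searchStep (search r j) j (r j)

allPos : Vec ℕ m → ℕ
allPos [] = 1
allPos (v ∷ vs) = ifPos v (allPos vs)

-- run f k xs is 1 + f(xs) if the computation succeeds when every μ-search is
-- cut off after k + 1 probes, and 0 otherwise.
mutual
  run : PR n → ℕ → Vec ℕ n → ℕ
  run zer k xs = 1
  run succ k (x ∷ []) = suc (suc x)
  run (proj i) k xs = suc (lookup xs i)
  run (comp f gs) k xs = ifPos (allPos (runAll gs k xs)) (run f k (map pred (runAll gs k xs)))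
  run (prec g h) k (m ∷ xs) = runRec g h k m xs
  run (mu f) k xs = pred (search (λ j → run f k (j ∷ xs)) (suc k))

  runAll : Vec (PR n) m → ℕ → Vec ℕ n → Vec ℕ m
  runAll [] k xs = []
  runAll (g ∷ gs) k xs = run g k xs ∷ runAll gs k xs

  runRec : PR n → PR (suc (suc n)) → ℕ → ℕ → Vec ℕ n → ℕ
  runRec g h k zero xs = run g k xs
  runRec g h k (suc m) xs = ifPos (runRec g h k m xs) (run h k (m ∷ pred (runRec g h k m xs) ∷ xs))

searchStepᶜ : Computable₃ searchStep
searchStepᶜ = cast (caseᶜ zeroᶜ (caseᶜ probing plus2))
  λ { (zero ∷ j ∷ c ∷ []) → refl
    ; (suc zero ∷ j ∷ zero ∷ []) → refl
    ; (suc zero ∷ j ∷ suc zero ∷ []) → refl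
    ; (suc zero ∷ j ∷ suc (suc c) ∷ []) → refl
    ; (suc (suc s) ∷ j ∷ c ∷ []) → refl }
  where
  plus2 : ∀ {n} → Computable (suc n) (λ v → suc (suc (lookup v zero)))
  plus2 = apply₁ sucᶜ (apply₁ sucᶜ (projᶜ zero))
  probing : Computable 2 (λ v → caseFn (λ _ → 0) (caseFn (λ w → suc (suc (lookup w zero))) (λ _ → 1))
                                       (lookup v (suc zero) ∷ lookup v zero ∷ []))
  probing = compose (caseᶜ zeroᶜ (caseᶜ plus2 oneᶜ)) (projᶜ (suc zero) ∷ᶜ projᶜ zero ∷ᶜ []ᶜ)

primRecFn-runRec : ∀ (g : PR n) h {G H} →
                   (∀ k xs → G (k ∷ xs) ≡ run g k xs) →
                   (∀ m r k xs → H (m ∷ r ∷ k ∷ xs) ≡ ifPos r (run h k (m ∷ pred r ∷ xs))) →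
                   ∀ m k xs → primRecFn G H (m ∷ k ∷ xs) ≡ runRec g h k m xs
primRecFn-runRec g h G≗ H≗ zero k xs = G≗ k xs
primRecFn-runRec g h {H = H} G≗ H≗ (suc m) k xs =
  trans (H≗ m _ k xs)
        (cong (λ r → ifPos r (run h k (m ∷ pred r ∷ xs))) (primRecFn-runRec g h G≗ H≗ m k xs))

primRecFn-search : ∀ (f : PR (suc n)) {H} →
                   (∀ j s k xs → H (j ∷ s ∷ k ∷ xs) ≡ searchStep s j (run f k (j ∷ xs))) →
                   ∀ j k xs → primRecFn (λ _ → 1) H (j ∷ k ∷ xs) ≡ search (λ j → run f k (j ∷ xs)) j
primRecFn-search f H≗ zero k xs = refl
primRecFn-search f H≗ (suc j) k xs =
  trans (H≗ j _ k xs) (cong (λ s → searchStep s j (run f k (j ∷ xs))) (primRecFn-search f H≗ j k xs))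

mutual
  run-computable : (f : PR n) → Computable (suc n) (λ v → run f (head v) (tail v))
  run-computable zer = oneᶜ
  run-computable succ = cast (apply₁ sucᶜ (apply₁ sucᶜ (projᶜ (suc zero)))) λ { (k ∷ x ∷ []) → refl }
  run-computable (proj i) = cast (apply₁ sucᶜ (projᶜ (suc i))) λ { (k ∷ xs) → refl }
  run-computable (comp f gs) =
    cast (apply₂ ifPosᶜ (allPos-runAll-computable gs)
                        (compose (run-computable f) (projᶜ zero ∷ᶜ pred-runAll-computable gs)))
         λ { (k ∷ xs) → refl }
  run-computable (prec {n} g h) =
    cast (compose recursion (projᶜ (suc zero) ∷ᶜ projᶜ zero ∷ᶜ drop₂))
         λ { (k ∷ m ∷ xs) → primRecFn-runRec g h (λ _ _ → refl) (λ _ _ _ _ → refl) m k xs }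
    where
    step : Computable (3 + n) (λ v → ifPos (lookup v (suc zero))
                                           (run h (lookup v (suc (suc zero)))
                                                  (lookup v zero ∷ pred (lookup v (suc zero)) ∷ tail (tail (tail v)))))
    step = apply₂ ifPosᶜ (projᶜ (suc zero))
                  (compose (run-computable h)
                           (projᶜ (suc (suc zero)) ∷ᶜ projᶜ zero ∷ᶜ apply₁ predᶜ (projᶜ (suc zero))
                            ∷ᶜ drop₃))
    recursion : Computable (2 + n) (primRecFn (λ v → run g (head v) (tail v)) (computedFn step))
    recursion = primRec (run-computable g) step
  run-computable {n} (mu f) =
    cast (apply₁ predᶜ (compose searching (apply₁ sucᶜ (projᶜ zero) ∷ᶜ projᶜ zero ∷ᶜ drop₁)))
         λ { (k ∷ xs) → cong pred (primRecFn-search f {computedFn step} (λ _ _ _ _ → refl) (suc k) k xs) }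
    where
    step : Computable (3 + n) (λ v → searchStep (lookup v (suc zero)) (lookup v zero)
                                                (run f (lookup v (suc (suc zero))) (lookup v zero ∷ tail (tail (tail v)))))
    step = apply₃ searchStepᶜ (projᶜ (suc zero)) (projᶜ zero)
                  (compose (run-computable f) (projᶜ (suc (suc zero)) ∷ᶜ projᶜ zero ∷ᶜ drop₃))
    searching : Computable (2 + n) (primRecFn (λ _ → 1) (computedFn step))
    searching = primRec oneᶜ step

  allPos-runAll-computable : (gs : Vec (PR n) m) →
                             Computable (suc n) (λ v → allPos (runAll gs (head v) (tail v)))
  allPos-runAll-computable [] = oneᶜ
  allPos-runAll-computable (g ∷ gs) = apply₂ ifPosᶜ (run-computable g) (allPos-runAll-computable gs)

  pred-runAll-computable : (gs : Vec (PR n) m) →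
                           ComputableVec (suc n) m (λ v → map pred (runAll gs (head v) (tail v)))
  pred-runAll-computable [] = []ᶜ
  pred-runAll-computable (g ∷ gs) = apply₁ predᶜ (run-computable g) ∷ᶜ pred-runAll-computable gs

PositiveBelow : (ℕ → ℕ) → ℕ → Set
PositiveBelow r y = ∀ z → z < y → ∃ λ w → r z ≡ suc (suc w)

<-suc-cases : ∀ {z j} → z < suc j → z < j ⊎ z ≡ j
<-suc-cases z<1+j = m≤n⇒m<n∨m≡n (≤-pred z<1+j)

search-searching : ∀ r j → search r j ≡ 1 → PositiveBelow r j
search-searching r (suc j) e z z<1+j with search r j in state | r j in probe
search-searching r (suc j) e z z<1+j | suc zero | suc (suc c) with <-suc-cases z<1+j
... | inj₁ z<j = search-searching r j state z z<j
... | inj₂ refl = c , probe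
search-searching r (suc j) () z z<1+j | zero | _
search-searching r (suc j) () z z<1+j | suc zero | zero
search-searching r (suc j) () z z<1+j | suc zero | suc zero
search-searching r (suc j) () z z<1+j | suc (suc s) | _

search-found : ∀ r j y → search r j ≡ suc (suc y) → r y ≡ 1 × PositiveBelow r y
search-found r (suc j) y e with search r j in state | r j in probe
search-found r (suc j) .j refl | suc zero | suc zero = probe , search-searching r j state
search-found r (suc j) y refl | suc (suc s) | _ = search-found r j y state
search-found r (suc j) y () | zero | _
search-found r (suc j) y () | suc zero | zero
search-found r (suc j) y () | suc zero | suc (suc c)

search-before : ∀ r y → PositiveBelow r y → ∀ j → j ≤ y → search r j ≡ 1
search-before r y pos zero _ = refl
search-before r y pos (suc j) j<y
  rewrite search-before r y pos j (<⇒≤ j<y) | proj₂ (pos j j<y) = refl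

search-after : ∀ r y → r y ≡ 1 → PositiveBelow r y → ∀ j → y < j → search r j ≡ suc (suc y)
search-after r y ry≡1 pos (suc j) y<1+j with <-suc-cases y<1+j
... | inj₁ y<j rewrite search-after r y ry≡1 pos j y<j = refl
... | inj₂ refl rewrite search-before r y pos y ≤-refl | ry≡1 = refl

pred≡1+⇒≡2+ : ∀ {s v} → pred s ≡ suc v → s ≡ suc (suc v)
pred≡1+⇒≡2+ {suc (suc _)} refl = refl

mutual
  run-sound : ∀ (f : PR n) k xs {v} → run f k xs ≡ suc v → Eval f xs v
  run-sound zer k xs refl = ev-zer
  run-sound succ k (x ∷ []) refl = ev-succ
  run-sound (proj i) k xs refl = ev-proj
  run-sound (comp f gs) k xs e with allPos (runAll gs k xs) in all-defined
  ... | suc _ = ev-comp (runAll-sound gs k xs all-defined) (run-sound f k _ e)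
  run-sound (prec g h) k (m ∷ xs) e = runRec-sound g h k m xs e
  run-sound (mu f) k xs {v} e with search-found _ (suc k) v (pred≡1+⇒≡2+ e)
  ... | fv≡0 , pos =
    ev-mu (run-sound f k _ fv≡0) (λ z z<v → proj₁ (pos z z<v) , run-sound f k _ (proj₂ (pos z z<v)))

  runAll-sound : ∀ (gs : Vec (PR n) m) k xs {a} → allPos (runAll gs k xs) ≡ suc a →
                 EvalVec gs xs (map pred (runAll gs k xs))
  runAll-sound [] k xs e = evv-[]
  runAll-sound (g ∷ gs) k xs e with run g k xs in eg
  ... | suc _ = evv-∷ (run-sound g k xs eg) (runAll-sound gs k xs e)

  runRec-sound : ∀ (g : PR n) h k m xs {v} → runRec g h k m xs ≡ suc v → Eval (prec g h) (m ∷ xs) v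
  runRec-sound g h k zero xs e = ev-prec-zero (run-sound g k xs e)
  runRec-sound g h k (suc m) xs e with runRec g h k m xs in er
  ... | suc _ = ev-prec-suc (runRec-sound g h k m xs er) (run-sound h k _ e)

Eventually : (ℕ → Set) → Set
Eventually P = ∃ λ k₀ → ∀ k → k₀ ≤ k → P k

eventually-× : ∀ {P Q : ℕ → Set} → Eventually P → Eventually Q → Eventually (λ k → P k × Q k)
eventually-× (k₁ , p) (k₂ , q) =
  k₁ ⊔ k₂ , λ k le → p k (≤-trans (m≤m⊔n k₁ k₂) le) , q k (≤-trans (m≤n⊔m k₁ k₂) le)

eventually-∀< : ∀ {P : ℕ → ℕ → Set} y → (∀ z → z < y → Eventually (P z)) →
                Eventually (λ k → ∀ z → z < y → P z k)
eventually-∀< zero _ = 0 , λ _ _ _ ()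
eventually-∀< {P} (suc y) ev
  with eventually-× (eventually-∀< y (λ z z<y → ev z (m<n⇒m<1+n z<y))) (ev y ≤-refl)
... | k₀ , both = k₀ , λ k le z z<1+y → at k le z (<-suc-cases z<1+y)
  where
  at : ∀ k → k₀ ≤ k → ∀ z → z < y ⊎ z ≡ y → P z k
  at k le z (inj₁ z<y) = proj₁ (both k le) z z<y
  at k le z (inj₂ refl) = proj₂ (both k le)

allPos-map-suc : ∀ (ys : Vec ℕ m) → allPos (map suc ys) ≡ 1
allPos-map-suc [] = refl
allPos-map-suc (y ∷ ys) = allPos-map-suc ys

map-pred-suc : ∀ (ys : Vec ℕ m) → map pred (map suc ys) ≡ ys
map-pred-suc ys = trans (sym (map-∘ pred suc ys)) (map-id ys)

mutual
  run-complete : ∀ {f : PR n} {xs v} → Eval f xs v → Eventually (λ k → run f k xs ≡ suc v)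
  run-complete ev-zer = 0 , λ _ _ → refl
  run-complete ev-succ = 0 , λ _ _ → refl
  run-complete ev-proj = 0 , λ _ _ → refl
  run-complete (ev-comp {f = f} {gs = gs} {xs = xs} {ys = ys} {v = v} egs ef)
    with eventually-× (runAll-complete egs) (run-complete ef)
  ... | k₀ , both = k₀ , λ k le → comp-value k (both k le)
    where
    comp-value : ∀ k → runAll gs k xs ≡ map suc ys × run f k ys ≡ suc v → run (comp f gs) k xs ≡ suc v
    comp-value k (gs≡ , f≡) rewrite gs≡ | allPos-map-suc ys | map-pred-suc ys = f≡
  run-complete (ev-prec-zero eg) = run-complete eg
  run-complete (ev-prec-suc {g = g} {h = h} {k = m} {xs = xs} {r = r} {v = v} er eh)
    with eventually-× (run-complete er) (run-complete eh)
  ... | k₀ , both = k₀ , λ k le → rec-value k (both k le)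
    where
    rec-value : ∀ k → run (prec g h) k (m ∷ xs) ≡ suc r × run h k (m ∷ r ∷ xs) ≡ suc v →
                run (prec g h) k (suc m ∷ xs) ≡ suc v
    rec-value k (r≡ , h≡) rewrite r≡ = h≡
  run-complete (ev-mu {f = f} {xs = xs} {y = y} ef below) = mu-complete
    where
    below-complete : ∀ z → z < y → Eventually (λ k → ∃ λ w → run f k (z ∷ xs) ≡ suc (suc w))
    below-complete z z<y with below z z<y
    ... | w , ez with run-complete ez
    ... | k₀ , ev = k₀ , λ k le → w , ev k le

    mu-complete : Eventually (λ k → run (mu f) k xs ≡ suc y)
    mu-complete with eventually-× (eventually-× (y , λ _ y≤k → y≤k) (run-complete ef))
                                   (eventually-∀< y below-complete)
    ... | k₀ , all = k₀ , λ k le → let (y≤k , fy≡1) , pos = all k le in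
                                   cong pred (search-after _ y fy≡1 pos (suc k) (s≤s y≤k))

  runAll-complete : ∀ {gs : Vec (PR n) m} {xs ys} → EvalVec gs xs ys →
                    Eventually (λ k → runAll gs k xs ≡ map suc ys)
  runAll-complete evv-[] = 0 , λ _ _ → refl
  runAll-complete (evv-∷ eg egs) with eventually-× (run-complete eg) (runAll-complete egs)
  ... | k₀ , both = k₀ , λ k le → cong₂ _∷_ (proj₁ (both k le)) (proj₂ (both k le))

least-zero : ∀ (g : ℕ → ℕ) y → g y ≡ 0 →
             ∃ λ z → g z ≡ 0 × (∀ w → w < z → ∃ λ k → g w ≡ suc k)
least-zero g zero g0≡0 = 0 , g0≡0 , λ _ ()
least-zero g (suc y) gy≡0 with g 0 in g0 | least-zero (g ∘ suc) y gy≡0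
... | zero | _ = 0 , g0 , λ _ ()
... | suc k | z , gz≡0 , pos = suc z , gz≡0 , λ { zero _ → k , g0 ; (suc w) (s≤s w<z) → pos w w<z }

minimise-halts : (F : Computable (suc n) f) → ∀ xs y → f (y ∷ xs) ≡ 0 → ∃ (Eval (mu (code F)) xs)
minimise-halts {f = f} F xs y fy≡0 with least-zero (λ z → f (z ∷ xs)) y fy≡0
... | z , fz≡0 , pos =
  z , ev-mu (subst (Eval _ _) fz≡0 (eval F _))
            (λ w w<z → proj₁ (pos w w<z) , subst (Eval _ _) (proj₂ (pos w w<z)) (eval F _))

minimise-zero : (F : Computable (suc n) f) → ∀ {xs z} → Eval (mu (code F)) xs z → f (z ∷ xs) ≡ 0
minimise-zero F (ev-mu e _) = Eval-deterministic (eval F _) e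

record Σ₁ (R : Rel₂) : Set where
  field
    check : ℕ → ℕ → ℕ → ℕ
    check-computable : Computable₃ check
    check-sound : ∀ {t x y w} → check t x y ≡ suc w → R x y
    check-complete : ∀ {x y} → R x y → ∃₂ λ t w → check t x y ≡ suc w

isZero≡0 : ∀ {a} → isZero a ≡ 0 → ∃ λ w → a ≡ suc w
isZero≡0 {suc w} _ = w , refl

Σ₁⇒RecEnum : ∀ {R} → Σ₁ R → RecEnum R
Σ₁⇒RecEnum {R} R-Σ₁ = mu (code unchecked) , λ x y → halts x y , halted x y
  where
  open Σ₁ R-Σ₁
  unchecked : Computable 3 (λ v → isZero (check (head v) (head (tail v)) (head (tail (tail v)))))
  unchecked = apply₁ isZeroᶜ check-computable

  halts : ∀ x y → R x y → ∃ (Eval (mu (code unchecked)) (x ∷ y ∷ []))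
  halts x y Rxy with check-complete Rxy
  ... | t , w , ok = minimise-halts unchecked _ t (cong isZero ok)

  halted : ∀ x y → ∃ (Eval (mu (code unchecked)) (x ∷ y ∷ [])) → R x y
  halted x y (t , ev) = check-sound (proj₂ (isZero≡0 (minimise-zero unchecked ev)))

RecEnum⇒Σ₁ : ∀ {R} → RecEnum R → Σ₁ R
RecEnum⇒Σ₁ {R} (e , e-enumerates) = record
  { check = λ t x y → run e t (x ∷ y ∷ [])
  ; check-computable = cast (run-computable e) (λ { (t ∷ x ∷ y ∷ []) → refl })
  ; check-sound = λ {t} {x} {y} ok → proj₂ (e-enumerates x y) (_ , run-sound e t _ ok)
  ; check-complete = complete
  }
  where
  complete : ∀ {x y} → R x y → ∃₂ λ t w → run e t (x ∷ y ∷ []) ≡ suc w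
  complete {x} {y} Rxy with proj₁ (e-enumerates x y) Rxy
  ... | v , ev with run-complete ev
  ... | k₀ , ok = k₀ , v , ok k₀ ≤-refl

triangle : ℕ → ℕ
triangle zero = 0
triangle (suc m) = triangle m + suc m

-- diagonal n is the m with triangle m ≤ n < triangle (1 + m).
diagonal : ℕ → ℕ
diagonal zero = 0
diagonal (suc n) = diagonal n + eq (suc n) (triangle (suc (diagonal n)))

pair : ℕ → ℕ → ℕ
pair a b = triangle (a + b) + a

unpair₁ : ℕ → ℕ
unpair₁ n = n ∸ triangle (diagonal n)

unpair₂ : ℕ → ℕ
unpair₂ n = diagonal n ∸ unpair₁ n

diagonal-triangle+ : ∀ m a → a ≤ m → diagonal (triangle m + a) ≡ m
diagonal-triangle+ zero zero _ = refl
diagonal-triangle+ (suc m) zero _ = begin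
  diagonal (triangle m + suc m + 0)
    ≡⟨ cong diagonal (trans (+-identityʳ _) (+-suc (triangle m) m)) ⟩
  diagonal (triangle m + m) + eq (suc (triangle m + m)) (triangle (suc (diagonal (triangle m + m))))
    ≡⟨ cong (λ d → d + eq (suc (triangle m + m)) (triangle (suc d))) (diagonal-triangle+ m m ≤-refl) ⟩
  m + eq (suc (triangle m + m)) (triangle m + suc m)
    ≡⟨ cong (λ t → m + eq (suc (triangle m + m)) t) (+-suc (triangle m) m) ⟩
  m + eq (suc (triangle m + m)) (suc (triangle m + m))
    ≡⟨ cong (m +_) (eq-refl (triangle m + m)) ⟩
  m + 1
    ≡⟨ +-comm m 1 ⟩
  suc m ∎
  where open ≡-Reasoning
diagonal-triangle+ m (suc a) 1+a≤m = begin
  diagonal (triangle m + suc a)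
    ≡⟨ cong diagonal (+-suc (triangle m) a) ⟩
  diagonal (triangle m + a) + eq (suc (triangle m + a)) (triangle (suc (diagonal (triangle m + a))))
    ≡⟨ cong (λ d → d + eq (suc (triangle m + a)) (triangle (suc d))) (diagonal-triangle+ m a (<⇒≤ 1+a≤m)) ⟩
  m + eq (suc (triangle m + a)) (triangle m + suc m)
    ≡⟨ cong (m +_) (≢⇒eq-zero _ _ before-next) ⟩
  m + 0
    ≡⟨ +-identityʳ m ⟩
  m ∎
  where
  open ≡-Reasoning
  before-next : suc (triangle m + a) ≢ triangle m + suc m
  before-next e = <⇒≢ (+-monoʳ-< (triangle m) 1+a≤m) (suc-injective (trans e (+-suc (triangle m) m)))

unpair₁-pair : ∀ a b → unpair₁ (pair a b) ≡ a
unpair₁-pair a b rewrite diagonal-triangle+ (a + b) a (m≤m+n a b) = m+n∸m≡n (triangle (a + b)) a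

unpair₂-pair : ∀ a b → unpair₂ (pair a b) ≡ b
unpair₂-pair a b rewrite unpair₁-pair a b | diagonal-triangle+ (a + b) a (m≤m+n a b) = m+n∸m≡n a b

triangleᶜ : Computable₁ triangle
triangleᶜ = cast (primRec zeroᶜ (apply₂ addᶜ (projᶜ (suc zero)) (apply₁ sucᶜ (projᶜ zero))))
                 (λ { (m ∷ []) → triangle-rec m })
  where
  triangle-rec : ∀ m → primRecFn (λ _ → 0) (λ v → lookup v (suc zero) + suc (lookup v zero)) (m ∷ [])
                       ≡ triangle m
  triangle-rec zero = refl
  triangle-rec (suc m) = cong (_+ suc m) (triangle-rec m)

diagonalᶜ : Computable₁ diagonal
diagonalᶜ = cast (primRec zeroᶜ step) (λ { (n ∷ []) → diagonal-rec n })
  where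
  step : Computable 2 (λ v → lookup v (suc zero) + eq (suc (lookup v zero)) (triangle (suc (lookup v (suc zero)))))
  step = apply₂ addᶜ (projᶜ (suc zero))
                (apply₂ eqᶜ (apply₁ sucᶜ (projᶜ zero)) (apply₁ triangleᶜ (apply₁ sucᶜ (projᶜ (suc zero)))))
  diagonal-rec : ∀ n → primRecFn (λ _ → 0) (computedFn step) (n ∷ []) ≡ diagonal n
  diagonal-rec zero = refl
  diagonal-rec (suc n) = cong (λ d → d + eq (suc n) (triangle (suc d))) (diagonal-rec n)

pairᶜ : Computable₂ pair
pairᶜ = cast (apply₂ addᶜ (apply₁ triangleᶜ (apply₂ addᶜ (projᶜ zero) (projᶜ (suc zero))))
                          (projᶜ zero))
             (λ { (a ∷ b ∷ []) → refl })

unpair₁ᶜ : Computable₁ unpair₁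
unpair₁ᶜ = cast (apply₂ monusᶜ (projᶜ zero) (apply₁ triangleᶜ (apply₁ diagonalᶜ (projᶜ zero))))
                (λ { (n ∷ []) → refl })

unpair₂ᶜ : Computable₁ unpair₂
unpair₂ᶜ = cast (apply₂ monusᶜ (apply₁ diagonalᶜ (projᶜ zero)) (apply₁ unpair₁ᶜ (projᶜ zero)))
                (λ { (n ∷ []) → refl })

module _ {T : Rel₂} (T-Σ₁ : Σ₁ T) where
  open Σ₁ T-Σ₁

  -- A walk state is 0 after a failed step, or 1 + ⟨a, ⟨⟨t, b⟩, rest⟩⟩ when the
  -- walk is at a and t is the claimed witness for the next step a → b.
  stepFrom : ℕ → ℕ → ℕ → ℕ → ℕ
  stepFrom a t b rest = ifPos (check t a b) (suc (pair b rest))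

  walkStep : ℕ → ℕ
  walkStep zero = zero
  walkStep (suc s) = stepFrom (unpair₁ s) (unpair₁ (unpair₁ (unpair₂ s)))
                              (unpair₂ (unpair₁ (unpair₂ s))) (unpair₂ (unpair₂ s))

  walk : ℕ → ℕ → ℕ
  walk s zero = s
  walk s (suc n) = walkStep (walk s n)

  walk-suc : ∀ s n → walk s (suc n) ≡ walk (walkStep s) n
  walk-suc s zero = refl
  walk-suc s (suc n) = cong walkStep (walk-suc s n)

  walk-failed : ∀ n → walk 0 n ≡ 0
  walk-failed zero = refl
  walk-failed (suc n) = cong walkStep (walk-failed n)

  walkStep-pair : ∀ a t b rest → walkStep (suc (pair a (pair (pair t b) rest))) ≡ stepFrom a t b rest
  walkStep-pair a t b rest = begin
    walkStep (suc (pair a (pair tb rest)))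
      ≡⟨ cong₂ (λ a′ r → stepFrom a′ (unpair₁ (unpair₁ r)) (unpair₂ (unpair₁ r)) (unpair₂ r))
               (unpair₁-pair a (pair tb rest)) (unpair₂-pair a (pair tb rest)) ⟩
    stepFrom a (unpair₁ (unpair₁ (pair tb rest))) (unpair₂ (unpair₁ (pair tb rest))) (unpair₂ (pair tb rest))
      ≡⟨ cong₂ (λ tb′ rest′ → stepFrom a (unpair₁ tb′) (unpair₂ tb′) rest′)
               (unpair₁-pair tb rest) (unpair₂-pair tb rest) ⟩
    stepFrom a (unpair₁ tb) (unpair₂ tb) rest
      ≡⟨ cong₂ (λ t′ b′ → stepFrom a t′ b′ rest) (unpair₁-pair t b) (unpair₂-pair t b) ⟩
    stepFrom a t b rest ∎
    where
    open ≡-Reasoning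
    tb = pair t b

  -- a witness p = ⟨n, c⟩ describes a walk of n steps from x along the list c
  endpoint : ℕ → ℕ → ℕ
  endpoint p x = walk (suc (pair x (unpair₂ p))) (unpair₁ p)

  accepts : ℕ → ℕ → ℕ → ℕ
  accepts p x y = ifPos (endpoint p x) (eq (unpair₁ (pred (endpoint p x))) y)

  walk-sound : ∀ n s {q} → walk (suc s) n ≡ suc q → Star T (unpair₁ s) (unpair₁ q)
  walk-sound zero s refl = ε
  walk-sound (suc n) s {q} e rewrite walk-suc (suc s) n
    with check (unpair₁ (unpair₁ (unpair₂ s))) (unpair₁ s) (unpair₂ (unpair₁ (unpair₂ s))) in ok
  ... | zero = contradiction (trans (sym (walk-failed n)) e) 0≢1+n
  ... | suc _ = check-sound ok ◅ subst (λ b → Star T b (unpair₁ q)) (unpair₁-pair _ _) (walk-sound n _ e)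

  walk-complete : ∀ {x y} → Star T x y →
                  ∃₂ λ n c → ∃ λ c′ → walk (suc (pair x c)) n ≡ suc (pair y c′)
  walk-complete ε = 0 , 0 , 0 , refl
  walk-complete {x} {y} (_◅_ {j = b} Txb rest) with check-complete Txb | walk-complete rest
  ... | t , _ , ok | n , c , c′ , arrives = suc n , pair (pair t b) c , c′ , (begin
    walk (suc (pair x (pair (pair t b) c))) (suc n)   ≡⟨ walk-suc _ n ⟩
    walk (walkStep (suc (pair x (pair (pair t b) c)))) n ≡⟨ cong (λ s → walk s n) (walkStep-pair x t b c) ⟩
    walk (stepFrom x t b c) n                          ≡⟨ cong (λ r → walk (ifPos r (suc (pair b c))) n) ok ⟩
    walk (suc (pair b c)) n                            ≡⟨ arrives ⟩
    suc (pair y c′)                                    ∎)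
    where open ≡-Reasoning

  accepts-sound : ∀ {p x y w} → accepts p x y ≡ suc w → Star T x y
  accepts-sound {p} {x} {y} e with endpoint p x in arrives
  ... | suc q = subst₂ (Star T) (unpair₁-pair x (unpair₂ p)) (eq-pos⇒≡ _ _ e)
                       (walk-sound (unpair₁ p) (pair x (unpair₂ p)) arrives)

  accepts-complete : ∀ {x y} → Star T x y → ∃₂ λ p w → accepts p x y ≡ suc w
  accepts-complete {x} {y} x→y with walk-complete x→y
  ... | n , c , c′ , arrives = pair n c , 0 , accepted
    where
    accepted : accepts (pair n c) x y ≡ 1
    accepted = begin
      accepts (pair n c) x y
        ≡⟨ cong (λ e → ifPos e (eq (unpair₁ (pred e)) y)) reaches ⟩
      eq (unpair₁ (pair y c′)) y
        ≡⟨ cong (λ a → eq a y) (unpair₁-pair y c′) ⟩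
      eq y y
        ≡⟨ eq-refl y ⟩
      1 ∎
      where
      open ≡-Reasoning
      reaches : endpoint (pair n c) x ≡ suc (pair y c′)
      reaches = trans (cong₂ (λ c″ n′ → walk (suc (pair x c″)) n′) (unpair₂-pair n c) (unpair₁-pair n c))
                      arrives

  stepFromᶜ : Computable 4 (λ v → stepFrom (lookup v zero) (lookup v (suc zero)) (lookup v (suc (suc zero)))
                                          (lookup v (suc (suc (suc zero)))))
  stepFromᶜ = apply₂ ifPosᶜ
                     (apply₃ check-computable (projᶜ (suc zero)) (projᶜ zero) (projᶜ (suc (suc zero))))
                     (apply₁ sucᶜ (apply₂ pairᶜ (projᶜ (suc (suc zero))) (projᶜ (suc (suc (suc zero))))))

  walkStepᶜ : Computable₁ walkStep
  walkStepᶜ = cast (caseᶜ zeroᶜ (compose stepFromᶜ (a ∷ᶜ t ∷ᶜ b ∷ᶜ rest ∷ᶜ []ᶜ)))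
                   (λ { (zero ∷ []) → refl ; (suc s ∷ []) → refl })
    where
    a : Computable 1 (λ v → unpair₁ (lookup v zero))
    a = apply₁ unpair₁ᶜ (projᶜ zero)
    t : Computable 1 (λ v → unpair₁ (unpair₁ (unpair₂ (lookup v zero))))
    t = apply₁ unpair₁ᶜ (apply₁ unpair₁ᶜ (apply₁ unpair₂ᶜ (projᶜ zero)))
    b : Computable 1 (λ v → unpair₂ (unpair₁ (unpair₂ (lookup v zero))))
    b = apply₁ unpair₂ᶜ (apply₁ unpair₁ᶜ (apply₁ unpair₂ᶜ (projᶜ zero)))
    rest : Computable 1 (λ v → unpair₂ (unpair₂ (lookup v zero)))
    rest = apply₁ unpair₂ᶜ (apply₁ unpair₂ᶜ (projᶜ zero))

  walkᶜ : Computable₂ walk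
  walkᶜ = cast (apply₂ (primRec (projᶜ zero) (apply₁ walkStepᶜ (projᶜ (suc zero))))
                       (projᶜ (suc zero)) (projᶜ zero))
               (λ { (s ∷ n ∷ []) → walk-rec n s })
    where
    walk-rec : ∀ n s → primRecFn (λ v → lookup v zero) (λ v → walkStep (lookup v (suc zero))) (n ∷ s ∷ [])
                       ≡ walk s n
    walk-rec zero s = refl
    walk-rec (suc n) s = cong walkStep (walk-rec n s)

  acceptsᶜ : Computable₃ accepts
  acceptsᶜ = cast (apply₂ ifPosᶜ endpointᶜ
                          (apply₂ eqᶜ (apply₁ unpair₁ᶜ (apply₁ predᶜ endpointᶜ)) (projᶜ (suc (suc zero)))))
                  (λ { (p ∷ x ∷ y ∷ []) → refl })
    where
    endpointᶜ : Computable 3 (λ v → endpoint (lookup v zero) (lookup v (suc zero)))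
    endpointᶜ = cast (apply₂ walkᶜ
                             (apply₁ sucᶜ (apply₂ pairᶜ (projᶜ (suc zero)) (apply₁ unpair₂ᶜ (projᶜ zero))))
                             (apply₁ unpair₁ᶜ (projᶜ zero)))
                     (λ { (p ∷ x ∷ y ∷ []) → refl })

  Σ₁-Star : Σ₁ (Star T)
  Σ₁-Star = record
    { check = accepts
    ; check-computable = acceptsᶜ
    ; check-sound = λ {p} → accepts-sound {p}
    ; check-complete = accepts-complete
    }

module _ {M : Subset} {_≼_ : Rel₂} (≼-Σ₁ : Σ₁ _≼_) (segment : InitialSegment _≼_ M) where
  open Σ₁ ≼-Σ₁

  undecided : ℕ → ℕ → ℕ → ℕ
  undecided t x y = ifPos (isZero (check t x y)) (isZero (check t y x))

  undecidedᶜ : Computable₃ undecided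
  undecidedᶜ = cast (apply₂ ifPosᶜ (apply₁ isZeroᶜ check-computable) (apply₁ isZeroᶜ swapped))
                    (λ { (t ∷ x ∷ y ∷ []) → refl })
    where
    swapped : Computable 3 (λ v → check (lookup v zero) (lookup v (suc (suc zero))) (lookup v (suc zero)))
    swapped = apply₃ check-computable (projᶜ zero) (projᶜ (suc (suc zero))) (projᶜ (suc zero))

  chooseᶜ : Computable₃ (λ t x y → select (check t x y) x y)
  chooseᶜ = cast (apply₃ selectᶜ check-computable (projᶜ (suc zero)) (projᶜ (suc (suc zero))))
                 (λ { (t ∷ x ∷ y ∷ []) → refl })

  selector : PR 2
  selector = comp (code chooseᶜ) (mu (code undecidedᶜ) ∷ proj zero ∷ proj (suc zero) ∷ [])

  selector-eval : ∀ {x y t c} → Eval (mu (code undecidedᶜ)) (x ∷ y ∷ []) t → check t x y ≡ c →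
                  Eval selector (x ∷ y ∷ []) (select c x y)
  selector-eval halted refl = ev-comp (evv-∷ halted (evv-∷ ev-proj (evv-∷ ev-proj evv-[]))) (eval chooseᶜ _)

  comparable-decided : ∀ {x y} → x ≼ y ⊎ y ≼ x → ∃ (Eval (mu (code undecidedᶜ)) (x ∷ y ∷ []))
  comparable-decided {x} {y} (inj₁ x≼y) with check-complete x≼y
  ... | t , _ , ok = minimise-halts undecidedᶜ _ t (cong (λ c → ifPos (isZero c) (isZero (check t y x))) ok)
  comparable-decided {x} {y} (inj₂ y≼x) with check-complete y≼x
  ... | t , _ , ok = minimise-halts undecidedᶜ _ t
                       (trans (cong (λ c → ifPos (isZero (check t x y)) (isZero c)) ok) (ifPos-zero _))

  selector-selects : ∀ x y → ExactlyOne M x y →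
                     Σ ℕ λ v → Eval selector (x ∷ y ∷ []) v × (v ≡ x ⊎ v ≡ y) × M v
  selector-selects x y (inj₁ (x∈M , y∉M)) with segment x y x∈M y∉M
  ... | x≼y , y⋠x with comparable-decided (inj₁ x≼y)
  ... | t , halted with check t y x in yx | check t x y in xy
  ... | suc _ | _ = contradiction (check-sound yx) y⋠x
  ... | zero | suc _ = x , selector-eval halted xy , inj₁ refl , x∈M
  ... | zero | zero = contradiction (minimise-zero undecidedᶜ halted) stuck
    where
    stuck : undecided t x y ≢ 0
    stuck rewrite xy | yx = λ ()
  selector-selects x y (inj₂ (x∉M , y∈M)) with segment y x y∈M x∉M
  ... | y≼x , x⋠y with comparable-decided (inj₂ y≼x)
  ... | t , halted with check t x y in xy
  ... | suc _ = contradiction (check-sound xy) x⋠y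
  ... | zero = y , selector-eval halted xy , inj₂ refl , y∈M

  Σ₁-initialSegment⇒weaklySemirecursive : WeaklySemirecursive M
  Σ₁-initialSegment⇒weaklySemirecursive = selector , selector-selects

Chooses : PR 2 → Rel₂
Chooses ψ x y = Eval ψ (x ∷ y ∷ []) x

Σ₁-Chooses : ∀ ψ → Σ₁ (Chooses ψ)
Σ₁-Chooses ψ = record
  { check = λ t x y → eq (run ψ t (x ∷ y ∷ [])) (suc x)
  ; check-computable = cast (apply₂ eqᶜ (run-computable ψ) (apply₁ sucᶜ (projᶜ (suc zero))))
                            (λ { (t ∷ x ∷ y ∷ []) → refl })
  ; check-sound = λ {t} ok → run-sound ψ t _ (eq-pos⇒≡ _ _ ok)
  ; check-complete = complete
  }
  where
  complete : ∀ {x y} → Chooses ψ x y → ∃₂ λ t w → eq (run ψ t (x ∷ y ∷ [])) (suc x) ≡ suc w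
  complete {x} ψxy with run-complete ψxy
  ... | k₀ , ok = k₀ , 0 , trans (cong (λ r → eq r (suc x)) (ok k₀ ≤-refl)) (eq-refl x)

module _ {M : Subset} {ψ : PR 2}
         (ψ-selects : ∀ x y → ExactlyOne M x y → Σ ℕ λ v → Eval ψ (x ∷ y ∷ []) v × (v ≡ x ⊎ v ≡ y) × M v)
         where

  Chooses-preserves-∉ : ∀ {a b} → Chooses ψ a b → ¬ M a → ¬ M b
  Chooses-preserves-∉ {a} {b} ψab a∉M b∈M with ψ-selects a b (inj₂ (a∉M , b∈M))
  ... | v , ψab≡v , _ , v∈M = a∉M (subst M (Eval-deterministic ψab≡v ψab) v∈M)

  Star-Chooses-preserves-∉ : ∀ {a b} → Star (Chooses ψ) a b → ¬ M a → ¬ M b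
  Star-Chooses-preserves-∉ ε a∉M = a∉M
  Star-Chooses-preserves-∉ (ψac ◅ c→b) a∉M =
    Star-Chooses-preserves-∉ c→b (Chooses-preserves-∉ ψac a∉M)

  Star-Chooses-initialSegment : InitialSegment (Star (Chooses ψ)) M
  Star-Chooses-initialSegment x y x∈M y∉M with ψ-selects x y (inj₁ (x∈M , y∉M))
  ... | v , ψxy≡v , inj₁ refl , _ = ψxy≡v ◅ ε , λ y→x → Star-Chooses-preserves-∉ y→x y∉M x∈M
  ... | v , _ , inj₂ refl , v∈M = contradiction v∈M y∉M

theorem4 : (M : Subset) →
    WeaklySemirecursive M ⇔
      (Σ Rel₂ λ _≼_ → QuasiOrdering _≼_ × RecEnum _≼_ × InitialSegment _≼_ M)
theorem4 M = mk⇔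
  (λ (ψ , ψ-selects) → Star (Chooses ψ) , Star-isPreorder (Chooses ψ) ,
                        Σ₁⇒RecEnum (Σ₁-Star (Σ₁-Chooses ψ)) , Star-Chooses-initialSegment ψ-selects)
  (λ (_ , _ , ≼-recEnum , segment) →
     Σ₁-initialSegment⇒weaklySemirecursive (RecEnum⇒Σ₁ ≼-recEnum) segment)
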